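{- For every $f:\{0,1\}^n\to\{0,1\}$ there is a unique minimal (with respect to the coordinatewise order on $\{0,1\}^n$) orientation, namely the $\beta\in\{0,1\}^n$ with $\beta_i=1$ if and only if there exist $u,v\in\{0,1\}^n$ with $u_i=0$, $v_i=1$, $u_j=v_j$ for all $j\neq i$, $f(u)=1$ and $f(v)=0$.
   Context: $f$ has orientation $\beta\in\{0,1\}^n$ if there is a monotone $h:\{0,1\}^{2n}\to\{0,1\}$ with $f(x)=h(x,x\oplus\beta)$ for all $x$. For $x,y\in\{0,1\}^n$, $x\le y$ iff $x_i\le y_i$ for all $i$. -}

module Defs where

open import Data.Bool using (Bool; true; false; _xor_; _≤_)
open import Data.Nat using (ℕ; _+_)
open import Data.Fin using (Fin)
open import Data.Vec using (Vec; lookup; zipWith; _++_)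
open import Data.Product using (Σ; _×_; ∃₂)
open import Relation.Binary.PropositionalEquality using (_≡_; _≢_)
open import Relation.Nullary using (¬_)

Cube : ℕ → Set
Cube n = Vec Bool n

_≼_ : ∀ {n} → Cube n → Cube n → Set
x ≼ y = ∀ i → lookup x i ≤ lookup y i

Monotone : ∀ {m} → (Cube m → Bool) → Set
Monotone {m} h = ∀ (x y : Cube m) → x ≼ y → h x ≤ h y

_⊕_ : ∀ {n} → Cube n → Cube n → Cube n
x ⊕ y = zipWith _xor_ x y

HasOrientation : ∀ {n} → (Cube n → Bool) → Cube n → Set
HasOrientation {n} f β =
  Σ (Cube (n + n) → Bool) λ h → Monotone h × (∀ x → f x ≡ h (x ++ (x ⊕ β)))

MinimalOrientation : ∀ {n} → (Cube n → Bool) → Cube n → Set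
MinimalOrientation f β =
  HasOrientation f β × (∀ α → HasOrientation f α → α ≼ β → α ≡ β)

NegativeEdge : ∀ {n} → (Cube n → Bool) → Fin n → Set
NegativeEdge f i =
  ∃₂ λ u v → lookup u i ≡ false × lookup v i ≡ true
           × (∀ j → j ≢ i → lookup u j ≡ lookup v j)
           × f u ≡ true × f v ≡ false

module Submission where

-- Call a coordinate i *negative* for f when some edge in direction i is
-- traversed by f from 1 to 0 (NegativeEdge f i).  The whole proposition rests
-- on a characterisation of orientations:
--
--   f has orientation β  iff  every negative coordinate i has β_i = 1.
--
-- (⇒) If β_i = 0, a negative edge u → v in direction i gives
--     (u , u ⊕ β) ≼ (v , v ⊕ β), contradicting monotonicity of h.
-- (⇐) Take for h the monotone hull of f along the embedding x ↦ (x , x ⊕ β):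
--     h w = 1 iff (z , z ⊕ β) ≼ w for some z with f z = 1.  It is monotone by
--     construction, and h (x , x ⊕ β) = f x follows from the climbing lemma:
--     raising coordinates on which f has no negative edge never turns 1 into 0.
-- Negativity is decidable by exhaustive search of the cube, so the indicator
-- vector of negative coordinates exists; by (⇐) it is an orientation and by
-- (⇒) it lies below every orientation.  A least element of a set is its unique
-- minimal element, which gives the proposition.

open import Defs
open import Data.Bool using (Bool; true; false; _xor_; f≤t; b≤b; _≤_)
open import Data.Bool.Properties
  using (≤-refl; ≤-reflexive; ≤-trans; ≤-antisym; ≤-minimum)
  renaming (_≟_ to _≟ᵇ_; _≤?_ to _≤ᵇ?_)
open import Data.Nat using (ℕ; zero; suc; _+_)
open import Data.Fin using (Fin; zero; suc; _≟_)
open import Data.Fin.Properties using (all?)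
open import Data.Vec using ([]; _∷_; lookup; tabulate; _++_)
open import Data.Vec.Properties
  using (lookup-zipWith; lookup∘tabulate; tabulate∘lookup; tabulate-cong)
open import Data.Product using (Σ; _×_; _,_; ∃)
open import Function.Bundles using (_⇔_; mk⇔; Equivalence)
open import Relation.Nullary using (¬_; Dec; yes; no; does; contradiction)
open import Relation.Nullary.Decidable using (¬?; _×-dec_; _→-dec_)
open import Relation.Binary.PropositionalEquality
  using (_≡_; _≢_; refl; sym; trans; cong; subst₂; module ≡-Reasoning)

≼-refl : ∀ {n} {x : Cube n} → x ≼ x
≼-refl i = ≤-refl

≼-trans : ∀ {n} {x y z : Cube n} → x ≼ y → y ≼ z → x ≼ z
≼-trans x≼y y≼z i = ≤-trans (x≼y i) (y≼z i)

≼-antisym : ∀ {n} {x y : Cube n} → x ≼ y → y ≼ x → x ≡ y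
≼-antisym {x = x} {y} x≼y y≼x = begin
  x                     ≡⟨ tabulate∘lookup x ⟨
  tabulate (lookup x)   ≡⟨ tabulate-cong (λ i → ≤-antisym (x≼y i) (y≼x i)) ⟩
  tabulate (lookup y)   ≡⟨ tabulate∘lookup y ⟩
  y                     ∎
  where open ≡-Reasoning

++-mono-≼ : ∀ {n m} {x x′ : Cube n} {y y′ : Cube m} →
  x ≼ x′ → y ≼ y′ → (x ++ y) ≼ (x′ ++ y′)
++-mono-≼ {x = []}    {[]}      x≼x′ y≼y′ i       = y≼y′ i
++-mono-≼ {x = _ ∷ _} {_ ∷ _}   x≼x′ y≼y′ zero    = x≼x′ zero
++-mono-≼ {x = _ ∷ x} {_ ∷ x′} x≼x′ y≼y′ (suc i) = ++-mono-≼ {x = x} {x′} (λ j → x≼x′ (suc j)) y≼y′ i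

++-≼⁻¹ : ∀ {n m} {x x′ : Cube n} {y y′ : Cube m} →
  (x ++ y) ≼ (x′ ++ y′) → x ≼ x′ × y ≼ y′
++-≼⁻¹ {x = []}    {[]}    le = (λ ()) , le
++-≼⁻¹ {x = _ ∷ x} {_ ∷ x′} le with ++-≼⁻¹ {x = x} {x′} (λ j → le (suc j))
... | x≼x′ , y≼y′ = (λ { zero → le zero ; (suc j) → x≼x′ j }) , y≼y′

edge-≼ : ∀ {n} {u v : Cube n} (i : Fin n) → lookup u i ≡ false →
  (∀ j → j ≢ i → lookup u j ≡ lookup v j) → u ≼ v
edge-≼ i uᵢ agree j with j ≟ i
... | yes refl = subst₂ _≤_ (sym uᵢ) refl (≤-minimum _)
... | no j≢i   = ≤-reflexive (agree j j≢i)

edge-⊕-≼ : ∀ {n} {u v : Cube n} (α : Cube n) (i : Fin n) → lookup α i ≡ false →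
  lookup u i ≡ false → (∀ j → j ≢ i → lookup u j ≡ lookup v j) → (u ⊕ α) ≼ (v ⊕ α)
edge-⊕-≼ {u = u} {v} α i αᵢ uᵢ agree = edge-≼ {u = u ⊕ α} {v ⊕ α} i flipped-uᵢ flipped-agree
  where
  flipped-uᵢ : lookup (u ⊕ α) i ≡ false
  flipped-uᵢ = trans (lookup-zipWith _xor_ i u α) (subst₂ (λ a b → a xor b ≡ false) (sym uᵢ) (sym αᵢ) refl)
  flipped-agree : ∀ j → j ≢ i → lookup (u ⊕ α) j ≡ lookup (v ⊕ α) j
  flipped-agree j j≢i = trans (lookup-zipWith _xor_ j u α)
    (trans (cong (_xor lookup α j) (agree j j≢i)) (sym (lookup-zipWith _xor_ j v α)))

-- Flipping by 1 reverses the order of bits; so if z ≼ x and also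
-- z ⊕ β ≼ x ⊕ β, then z and x agree wherever β is 1.

xor-true-antitone : ∀ {a c} → (a xor true) ≤ (c xor true) → c ≤ a
xor-true-antitone {false} {false} _ = b≤b
xor-true-antitone {true}  {false} _ = f≤t
xor-true-antitone {true}  {true}  _ = b≤b

⊕-≼-agree : ∀ {n} {z x : Cube n} (β : Cube n) → z ≼ x → (z ⊕ β) ≼ (x ⊕ β) →
  ∀ i → lookup β i ≡ true → lookup z i ≡ lookup x i
⊕-≼-agree {z = z} {x} β z≼x flipped i βᵢ = ≤-antisym (z≼x i) (xor-true-antitone flipped-at-i)
  where
  flipped-at-i : (lookup z i xor true) ≤ (lookup x i xor true)
  flipped-at-i = subst₂ _≤_
    (trans (lookup-zipWith _xor_ i z β) (cong (lookup z i xor_) βᵢ))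
    (trans (lookup-zipWith _xor_ i x β) (cong (lookup x i xor_) βᵢ))
    (flipped i)

any-cube? : ∀ n {P : Cube n → Set} → (∀ z → Dec (P z)) → Dec (∃ P)
any-cube? zero P? with P? []
... | yes p = yes ([] , p)
... | no ¬p = no λ { ([] , p) → ¬p p }
any-cube? (suc n) P? with any-cube? n (λ z → P? (false ∷ z)) | any-cube? n (λ z → P? (true ∷ z))
... | yes (z , p) | _            = yes (false ∷ z , p)
... | no _        | yes (z , p)  = yes (true ∷ z , p)
... | no ¬p₀      | no ¬p₁       = no λ { (false ∷ z , p) → ¬p₀ (z , p) ; (true ∷ z , p) → ¬p₁ (z , p) }

≼? : ∀ {n} (x y : Cube n) → Dec (x ≼ y)
≼? x y = all? (λ i → lookup x i ≤ᵇ? lookup y i)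

negativeEdge? : ∀ {n} (f : Cube n → Bool) (i : Fin n) → Dec (NegativeEdge f i)
negativeEdge? {n} f i with any-cube? n (λ u → any-cube? n (λ v →
    (lookup u i ≟ᵇ false) ×-dec (lookup v i ≟ᵇ true)
    ×-dec all? (λ j → ¬? (j ≟ i) →-dec (lookup u j ≟ᵇ lookup v j))
    ×-dec (f u ≟ᵇ true) ×-dec (f v ≟ᵇ false)))
... | yes (u , v , uᵢ , vᵢ , agree , fu , fv) = yes (u , v , uᵢ , vᵢ , (λ j → agree j) , fu , fv)
... | no ∄edge = no λ { (u , v , uᵢ , vᵢ , agree , fu , fv) → ∄edge (u , v , uᵢ , vᵢ , (λ j → agree j) , fu , fv) }

does≡true⇔ : ∀ {A : Set} (a? : Dec A) → (does a? ≡ true) ⇔ A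
does≡true⇔ (yes a) = mk⇔ (λ _ → a) (λ _ → refl)
does≡true⇔ (no ¬a) = mk⇔ (λ ()) (λ a → contradiction a ¬a)

non-negative-step : ∀ {n} {g : Cube n → Bool} {i : Fin n} → ¬ NegativeEdge g i →
  ∀ {u v} → lookup u i ≡ false → lookup v i ≡ true →
  (∀ j → j ≢ i → lookup u j ≡ lookup v j) → g u ≡ true → g v ≡ true
non-negative-step {g = g} ¬neg {u} {v} uᵢ vᵢ agree gu with g v in gv
... | true  = refl
... | false = contradiction (u , v , uᵢ , vᵢ , agree , gu , gv) ¬neg

restrict-non-negative : ∀ {n} {g : Cube (suc n) → Bool} (a : Bool) {i : Fin n} →
  ¬ NegativeEdge g (suc i) → ¬ NegativeEdge (λ w → g (a ∷ w)) i
restrict-non-negative a ¬neg (u , v , uᵢ , vᵢ , agree , gu , gv) =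
  ¬neg (a ∷ u , a ∷ v , uᵢ , vᵢ , agree′ , gu , gv)
  where
  agree′ : ∀ j → j ≢ suc _ → lookup (a ∷ u) j ≡ lookup (a ∷ v) j
  agree′ zero    _   = refl
  agree′ (suc j) j≢i = agree j (λ { refl → j≢i refl })

climb : ∀ {n} (g : Cube n → Bool) (β : Cube n) →
  (∀ i → lookup β i ≡ false → ¬ NegativeEdge g i) →
  ∀ {z x} → z ≼ x → (∀ i → lookup β i ≡ true → lookup z i ≡ lookup x i) →
  g z ≡ true → g x ≡ true
climb g [] _ {[]} {[]} _ _ gz = gz
climb g (b ∷ β) non-neg {z₀ ∷ z} {x₀ ∷ x} z≼x agree gz =
  climb-head (non-neg zero) (z≼x zero) (agree zero) tail-climbed
  where
  tail-climbed : g (z₀ ∷ x) ≡ true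
  tail-climbed = climb (λ w → g (z₀ ∷ w)) β
    (λ i βᵢ → restrict-non-negative z₀ (non-neg (suc i) βᵢ))
    {z} {x} (λ i → z≼x (suc i)) (λ i βᵢ → agree (suc i) βᵢ) gz

  climb-head : ∀ {b z₀ x₀} → (b ≡ false → ¬ NegativeEdge g zero) → z₀ ≤ x₀ →
    (b ≡ true → z₀ ≡ x₀) → g (z₀ ∷ x) ≡ true → g (x₀ ∷ x) ≡ true
  climb-head         _        b≤b _      g-z₀x = g-z₀x
  climb-head {true}  _        f≤t agree₀ _     = contradiction (agree₀ refl) λ ()
  climb-head {false} non-neg₀ f≤t _      g-z₀x = non-negative-step (non-neg₀ refl) refl refl
    (λ { zero 0≢0 → contradiction refl 0≢0 ; (suc j) _ → refl }) g-z₀x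

module MonotoneHull {n} (f : Cube n → Bool) (β : Cube n) where

  embed : Cube n → Cube (n + n)
  embed x = x ++ (x ⊕ β)

  below? : (w : Cube (n + n)) → Dec (∃ λ z → f z ≡ true × embed z ≼ w)
  below? w = any-cube? n (λ z → (f z ≟ᵇ true) ×-dec ≼? (embed z) w)

  hull : Cube (n + n) → Bool
  hull w = does (below? w)

  hull-monotone : Monotone hull
  hull-monotone w w′ w≼w′ with below? w | below? w′
  ... | no _              | _       = ≤-minimum _
  ... | yes _             | yes _   = b≤b
  ... | yes (z , fz , z≼w) | no ∄z  = contradiction (z , fz , ≼-trans {x = embed z} {w} {w′} z≼w w≼w′) ∄z

  hull-embed : (∀ i → lookup β i ≡ false → ¬ NegativeEdge f i) →
    ∀ x → f x ≡ hull (embed x)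
  hull-embed non-neg x with f x in fx | below? (embed x)
  ... | true  | yes _ = refl
  ... | true  | no ∄z = contradiction (x , fx , ≼-refl {x = embed x}) ∄z
  ... | false | no _  = refl
  ... | false | yes (z , fz , z≼x) with ++-≼⁻¹ {x = z} {x} z≼x
  ...   | z≼x₁ , z≼x₂ =
    contradiction (trans (sym fx) (climb f β non-neg {z} {x} z≼x₁ (⊕-≼-agree {z = z} {x} β z≼x₁ z≼x₂) fz)) λ ()

non-negative⇒orientation : ∀ {n} (f : Cube n → Bool) (β : Cube n) →
  (∀ i → lookup β i ≡ false → ¬ NegativeEdge f i) → HasOrientation f β
non-negative⇒orientation f β non-neg = hull , hull-monotone , hull-embed non-neg
  where open MonotoneHull f β

orientation⇒negative-covered : ∀ {n} {f : Cube n → Bool} {α : Cube n} →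
  HasOrientation f α → ∀ i → NegativeEdge f i → lookup α i ≡ true
orientation⇒negative-covered {α = α} (h , h-mono , f≡h) i (u , v , uᵢ , vᵢ , agree , fu , fv)
  with lookup α i in αᵢ
... | true  = refl
... | false = contradiction true≤false λ ()
  where
  h-edge : h (u ++ (u ⊕ α)) ≤ h (v ++ (v ⊕ α))
  h-edge = h-mono _ _ (++-mono-≼ {x = u} {v} (edge-≼ {u = u} {v} i uᵢ agree) (edge-⊕-≼ {u = u} {v} α i αᵢ uᵢ agree))
  true≤false : true ≤ false
  true≤false = subst₂ _≤_ (trans (sym (f≡h u)) fu) (trans (sym (f≡h v)) fv) h-edge

negativeCoordinates : ∀ {n} → (Cube n → Bool) → Cube n
negativeCoordinates f = tabulate (λ i → does (negativeEdge? f i))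

negativeCoordinates-spec : ∀ {n} (f : Cube n → Bool) (i : Fin n) →
  (lookup (negativeCoordinates f) i ≡ true) ⇔ NegativeEdge f i
negativeCoordinates-spec f i rewrite lookup∘tabulate (λ j → does (negativeEdge? f j)) i =
  does≡true⇔ (negativeEdge? f i)

negativeCoordinates-orientation : ∀ {n} (f : Cube n → Bool) →
  HasOrientation f (negativeCoordinates f)
negativeCoordinates-orientation f = non-negative⇒orientation f _
  λ i βᵢ neg → contradiction (trans (sym βᵢ) (Equivalence.from (negativeCoordinates-spec f i) neg)) λ ()

negativeCoordinates-least : ∀ {n} (f : Cube n → Bool) (α : Cube n) →
  HasOrientation f α → negativeCoordinates f ≼ α
negativeCoordinates-least f α oriented i with lookup (negativeCoordinates f) i in βᵢ
... | false = ≤-minimum _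
... | true  = ≤-reflexive (sym (orientation⇒negative-covered oriented i negative))
  where
  negative : NegativeEdge f i
  negative = Equivalence.to (negativeCoordinates-spec f i) βᵢ

least⇒minimal : ∀ {n} (P : Cube n → Set) (β : Cube n) → (∀ α → P α → β ≼ α) →
  ∀ α → P α → α ≼ β → α ≡ β
least⇒minimal P β least α Pα α≼β = ≼-antisym α≼β (least α Pα)

least⇒unique-minimal : ∀ {n} (P : Cube n → Set) (β : Cube n) → P β →
  (∀ α → P α → β ≼ α) → ∀ α → P α → (∀ γ → P γ → γ ≼ α → γ ≡ α) → α ≡ β
least⇒unique-minimal P β Pβ least α Pα α-minimal = sym (α-minimal β Pβ (least α Pα))

proposition2 : (n : ℕ) (f : Cube n → Bool) →
    Σ (Cube n) λ β →
      (∀ (i : Fin n) → (lookup β i ≡ true) ⇔ NegativeEdge f i)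
      × MinimalOrientation f β
      × (∀ α → MinimalOrientation f α → α ≡ β)
proposition2 n f =
  β , negativeCoordinates-spec f ,
  (β-orientation , least⇒minimal (HasOrientation f) β β-least) ,
  λ α (α-orientation , α-minimal) →
    least⇒unique-minimal (HasOrientation f) β β-orientation β-least α α-orientation α-minimal
  where
  β : Cube n
  β = negativeCoordinates f
  β-orientation : HasOrientation f β
  β-orientation = negativeCoordinates-orientation f
  β-least : ∀ α → HasOrientation f α → β ≼ α
  β-least = negativeCoordinates-least f
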